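{- Let $k\in\mathbb{Z}^+$ and $m=p_1^{a_1}\cdots p_r^{a_r}$, where $p_1,\ldots,p_r$ are distinct primes and $a_1,\ldots,a_r\in\mathbb{Z}^+$. Then $m$ is $k$-universal if and only if $p_1^{a_1},\ldots,p_r^{a_r}$ are all $k$-universal.
   Context: For $k\in\mathbb{N}=\{0,1,2,\ldots\}$ and $m\in\mathbb{Z}^+$ let $R_m(k)=\{\binom nk \bmod m:\ n\in\mathbb{N}\}$; $m$ is called $k$-universal if $R_m(k)=\mathbb{Z}/m\mathbb{Z}$. -}

module Defs where

open import Data.Nat using (ℕ; zero; suc; _<_; _^_; _*_)
open import Data.Nat.DivMod using (_%_)
open import Data.Nat.Combinatorics using (_C_)
open import Data.Product using (∃-syntax; _×_; proj₁; proj₂)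
open import Data.Empty using (⊥)
open import Data.List using (List; map)
open import Data.Nat.ListAction using (product)
open import Relation.Binary.PropositionalEquality using (_≡_)

-- R_m(k) = { C(n,k) mod m : n ∈ ℕ }; m is k-universal iff every residue
-- r ∈ {0,…,m-1} lies in R_m(k).  Only defined meaningfully for m ∈ ℤ⁺;
-- the m = 0 case is never used (it is set to ⊥).
KUniversal : ℕ → ℕ → Set
KUniversal k zero = ⊥
KUniversal k (suc m) = ∀ r → r < suc m → ∃[ n ] ((n C k) % suc m ≡ r)

primePowerProduct : List (ℕ × ℕ) → ℕ
primePowerProduct ps = product (map (λ pa → proj₁ pa ^ proj₂ pa) ps)

module Submission where

-- Write f(n) = C(n,k).  The forward direction is the easy
-- one: a residue r modulo a divisor d of m is reached by the same n that
-- reaches r modulo m, so universality passes to every factor pᵢ^aᵢ.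
--
-- For the converse we show that f is periodic modulo each prime power p^a,
-- with period p^(k+a).  The absorption identity j·C(M,j) = M·C(M-1,j-1)
-- gives M ∣ j·C(M,j); for M = p^(k+a) and 1 ≤ j ≤ k the factor j is not
-- divisible by p^(k+1), so p^a ∣ C(p^(k+a),j), and Vandermonde-style
-- induction on Pascal's rule turns this into C(n+M,k) ≡ C(n,k) (mod p^a).
-- The periods p^(k+a) for distinct primes are pairwise coprime, so the
-- Chinese remainder theorem lets us reach any residue modulo q·M from
-- residues reached modulo q and modulo M.

open import Defs
open import Data.Nat
open import Data.Nat.Properties
open import Data.Nat.Combinatorics using (_C_; nCk+nC[k+1]≡[n+1]C[k+1]; nC1≡n)
open import Data.Nat.Divisibility
open import Data.Nat.DivMod
open import Data.Nat.Coprimality using (Coprime; coprime-divisor; coprime-Bézout; 1-coprimeTo; prime⇒coprime)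
import Data.Nat.Coprimality as Coprime
open import Data.Nat.GCD using (module Bézout)
open import Data.Nat.Primality using (Prime; prime⇒nonZero; prime⇒nonTrivial; prime⇒irreducible)
open import Data.Nat.ListAction using (product)
open import Data.Nat.Solver using (module +-*-Solver)
open import Data.Product using (_×_; _,_; proj₁; proj₂; ∃-syntax)
open import Data.Sum using (inj₁; inj₂)
open import Data.Empty using (⊥-elim)
open import Data.List using (List; []; _∷_; map)
open import Data.List.Relation.Unary.All using (All; []; _∷_)
import Data.List.Relation.Unary.All as All
open import Data.List.Relation.Unary.Unique.Propositional using (Unique)
open import Data.List.Relation.Unary.AllPairs using ([]; _∷_)
open import Function using (id)
open import Function.Bundles using (_⇔_; mk⇔; Equivalence)
open import Relation.Binary.Definitions using (tri<; tri≈; tri>)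
open import Relation.Binary.PropositionalEquality
open import Relation.Nullary using (¬_; yes; no)

coprime-*ʳ : ∀ {n x y} → Coprime n x → Coprime n y → Coprime n (x * y)
coprime-*ʳ {n} {x} {y} n⊥x n⊥y {d} (d∣n , d∣xy) = n⊥y (d∣n , coprime-divisor d⊥x d∣xy)
  where
    d⊥x : Coprime d x
    d⊥x (e∣d , e∣x) = n⊥x (∣-trans e∣d d∣n , e∣x)

coprime-^ʳ : ∀ {n m} b → Coprime n m → Coprime n (m ^ b)
coprime-^ʳ {n} zero    _   = Coprime.sym (1-coprimeTo n)
coprime-^ʳ     (suc b) n⊥m = coprime-*ʳ n⊥m (coprime-^ʳ b n⊥m)

coprime-^ : ∀ {m n} a b → Coprime m n → Coprime (m ^ a) (n ^ b)
coprime-^ a b m⊥n = coprime-^ʳ b (Coprime.sym (coprime-^ʳ a (Coprime.sym m⊥n)))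

distinct-primes-coprime : ∀ {p q} → Prime p → Prime q → p ≢ q → Coprime p q
distinct-primes-coprime {p} {q} pp pq p≢q with <-cmp p q
... | tri< p<q _ _ = Coprime.sym (prime⇒coprime pq {{prime⇒nonZero pp}} p<q)
... | tri≈ _ p≡q _ = ⊥-elim (p≢q p≡q)
... | tri> _ _ q<p = prime⇒coprime pp {{prime⇒nonZero pq}} q<p

prime∤⇒coprime : ∀ {p j} → Prime p → ¬ (p ∣ j) → Coprime p j
prime∤⇒coprime pp p∤j (d∣p , d∣j) with prime⇒irreducible pp d∣p
... | inj₁ d≡1 = d≡1
... | inj₂ refl = ⊥-elim (p∤j d∣j)

coprime-∣-* : ∀ {q M z} → Coprime q M → q ∣ z → M ∣ z → q * M ∣ z
coprime-∣-* {q} {M} q⊥M (divides c refl) M∣cq =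
  subst (q * M ∣_) (*-comm q c)
    (*-monoʳ-∣ q (coprime-divisor (Coprime.sym q⊥M) (subst (M ∣_) (*-comm c q) M∣cq)))

pascal : ∀ n k → suc n C suc k ≡ n C k + n C suc k
pascal n k = sym (nCk+nC[k+1]≡[n+1]C[k+1] n k)

C-absorb : ∀ N j → suc j * (suc N C suc j) ≡ suc N * (N C j)
C-absorb zero    zero    = refl
C-absorb zero    (suc j) = *-zeroʳ (suc (suc j))
C-absorb (suc N) zero    =
  trans (*-identityˡ _) (trans (nC1≡n (suc (suc N))) (sym (*-identityʳ _)))
C-absorb (suc N) (suc j) = begin
  suc (suc j) * (suc (suc N) C suc (suc j))    ≡⟨ cong (suc (suc j) *_) (pascal (suc N) (suc j)) ⟩
  suc (suc j) * (X + Y)                         ≡⟨ *-distribˡ-+ (suc (suc j)) X Y ⟩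
  (X + suc j * X) + suc (suc j) * Y             ≡⟨ cong₂ (λ u v → (X + u) + v) (C-absorb N j) (C-absorb N (suc j)) ⟩
  (X + suc N * (N C j)) + suc N * (N C suc j)   ≡⟨ +-assoc X _ _ ⟩
  X + (suc N * (N C j) + suc N * (N C suc j))   ≡⟨ cong (X +_) (*-distribˡ-+ (suc N) (N C j) (N C suc j)) ⟨
  X + suc N * (N C j + N C suc j)               ≡⟨ cong (λ u → X + suc N * u) (pascal N j) ⟨
  X + suc N * X                                 ∎
  where
    open ≡-Reasoning
    X = suc N C suc j
    Y = suc N C suc (suc j)

M∣[1+j]*MC[1+j] : ∀ M j → M ∣ suc j * (M C suc j)
M∣[1+j]*MC[1+j] zero    j = subst (0 ∣_) (sym (*-zeroʳ (suc j))) (0 ∣0)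
M∣[1+j]*MC[1+j] (suc N) j = subst (suc N ∣_) (sym (C-absorb N j)) (m∣m*n (N C j))

C-shift : ∀ q .{{_ : NonZero q}} T K → (∀ j → 1 ≤ j → j ≤ K → q ∣ T C j) →
          ∀ n j → j ≤ K → ((n + T) C j) % q ≡ (n C j) % q
C-shift (suc q) T K q∣TCj zero    zero    _   = refl
C-shift (suc q) T K q∣TCj zero    (suc j) j≤K = n∣m⇒m%n≡0 (T C suc j) (suc q) (q∣TCj (suc j) (s≤s z≤n) j≤K)
C-shift q       T K q∣TCj (suc n) zero    _   = refl
C-shift q       T K q∣TCj (suc n) (suc j) j≤K = begin
  (suc (n + T) C suc j) % q                    ≡⟨ cong (_% q) (pascal (n + T) j) ⟩
  ((n + T) C j + (n + T) C suc j) % q          ≡⟨ %-distribˡ-+ ((n + T) C j) _ q ⟩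
  (((n + T) C j) % q + ((n + T) C suc j) % q) % q  ≡⟨ cong₂ (λ u v → (u + v) % q) shift-j shift-1+j ⟩
  ((n C j) % q + (n C suc j) % q) % q            ≡⟨ %-distribˡ-+ (n C j) _ q ⟨
  (n C j + n C suc j) % q                      ≡⟨ cong (_% q) (pascal n j) ⟨
  (suc n C suc j) % q                          ∎
  where
    open ≡-Reasoning
    shift-j : ((n + T) C j) % q ≡ (n C j) % q
    shift-j   = C-shift q T K q∣TCj n j (≤-trans (n≤1+n j) j≤K)
    shift-1+j : ((n + T) C suc j) % q ≡ (n C suc j) % q
    shift-1+j = C-shift q T K q∣TCj n (suc j) j≤K

n<p^n : ∀ {p} → 1 < p → ∀ n → n < p ^ n
n<p^n     1<p zero    = s≤s z≤n
n<p^n {p} 1<p (suc n) = begin-strict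
  suc n          ≤⟨ n<p^n 1<p n ⟩
  p ^ n          <⟨ m<m+n (p ^ n) (≤-trans (s≤s z≤n) (n<p^n 1<p n)) ⟩
  p ^ n + p ^ n  ≡⟨ cong (p ^ n +_) (+-identityʳ (p ^ n)) ⟨
  2 * p ^ n      ≤⟨ *-monoˡ-≤ (p ^ n) 1<p ⟩
  p ^ suc n      ∎
  where open ≤-Reasoning

cancel-prime-power : ∀ {p} → Prime p → ∀ c {a j X} →
                     ¬ (p ^ suc c ∣ j) → p ^ (c + a) ∣ j * X → p ^ a ∣ X
cancel-prime-power {p} pp c {a} {j} {X} p^[1+c]∤j p^[c+a]∣jX with p ∣? j
... | no p∤j = ∣-trans p^a∣p^[c+a] (coprime-divisor p^[c+a]⊥j p^[c+a]∣jX)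
  where
    p^a∣p^[c+a] : p ^ a ∣ p ^ (c + a)
    p^a∣p^[c+a] = subst (p ^ a ∣_) (sym (^-distribˡ-+-* p c a)) (n∣m*n (p ^ c))
    p^[c+a]⊥j : Coprime (p ^ (c + a)) j
    p^[c+a]⊥j = Coprime.sym (coprime-^ʳ (c + a) (Coprime.sym (prime∤⇒coprime pp p∤j)))
cancel-prime-power {p} pp zero {j = j} p^1∤j _ | yes p∣j =
  ⊥-elim (p^1∤j (subst (_∣ j) (sym (*-identityʳ p)) p∣j))
cancel-prime-power {p} pp (suc c) {a} {.(q * p)} {X} p^[2+c]∤qp p^[1+c+a]∣qpX | yes (divides q refl) =
  cancel-prime-power pp c p^[1+c]∤q (*-cancelˡ-∣ p (subst (p * p ^ (c + a) ∣_) qpX≡p[qX] p^[1+c+a]∣qpX))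
  where
    instance _ = prime⇒nonZero pp
    qpX≡p[qX] : q * p * X ≡ p * (q * X)
    qpX≡p[qX] = trans (cong (_* X) (*-comm q p)) (*-assoc p q X)
    p^[1+c]∤q : ¬ (p ^ suc c ∣ q)
    p^[1+c]∤q p^[1+c]∣q = p^[2+c]∤qp (subst (_∣ q * p) (*-comm (p ^ suc c) p) (*-monoˡ-∣ p p^[1+c]∣q))

p^a∣C : ∀ {p} → Prime p → ∀ a c j → 1 ≤ j → j ≤ c → p ^ a ∣ p ^ (c + a) C j
p^a∣C {p} pp a c (suc j) _ 1+j≤c =
  cancel-prime-power pp c p^[1+c]∤1+j (M∣[1+j]*MC[1+j] (p ^ (c + a)) j)
  where
    1+j<p^[1+c] : suc j < p ^ suc c
    1+j<p^[1+c] = <-trans (s≤s 1+j≤c) (n<p^n (nonTrivial⇒n>1 p {{prime⇒nonTrivial pp}}) (suc c))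
    p^[1+c]∤1+j : ¬ (p ^ suc c ∣ suc j)
    p^[1+c]∤1+j p^[1+c]∣1+j = <⇒≱ 1+j<p^[1+c] (∣⇒≤ p^[1+c]∣1+j)

Periodic : (ℕ → ℕ) → (q : ℕ) → .{{NonZero q}} → ℕ → Set
Periodic f q T = ∀ n t → f (n + t * T) % q ≡ f n % q

HitsAllResidues : (ℕ → ℕ) → (q : ℕ) → .{{NonZero q}} → Set
HitsAllResidues f q = ∀ r → r < q → ∃[ n ] (f n % q ≡ r)

periodic-step : ∀ f q .{{_ : NonZero q}} T → (∀ n → f (n + T) % q ≡ f n % q) → Periodic f q T
periodic-step f q T step n zero    = cong (λ m → f m % q) (+-identityʳ n)
periodic-step f q T step n (suc t) = begin
  f (n + (T + t * T)) % q  ≡⟨ cong (λ m → f m % q) n+[T+tT]≡[n+tT]+T ⟩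
  f ((n + t * T) + T) % q  ≡⟨ step (n + t * T) ⟩
  f (n + t * T) % q        ≡⟨ periodic-step f q T step n t ⟩
  f n % q                  ∎
  where
    open ≡-Reasoning
    n+[T+tT]≡[n+tT]+T : n + (T + t * T) ≡ (n + t * T) + T
    n+[T+tT]≡[n+tT]+T = trans (cong (n +_) (+-comm T (t * T))) (sym (+-assoc n (t * T) T))

binomial-periodic : ∀ q .{{_ : NonZero q}} T k → (∀ j → 1 ≤ j → j ≤ k → q ∣ T C j) →
                    Periodic (_C k) q T
binomial-periodic q T k q∣TCj = periodic-step (_C k) q T (λ n → C-shift q T k q∣TCj n k ≤-refl)

%-≡⇒∣∸ : ∀ x y d .{{_ : NonZero d}} → y ≤ x → x % d ≡ y % d → d ∣ x ∸ y
%-≡⇒∣∸ x y d y≤x x≡y = divides (x / d ∸ y / d) (begin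
  x ∸ y                                      ≡⟨ cong₂ _∸_ (m≡m%n+[m/n]*n x d) y≡ ⟩
  (x % d + x / d * d) ∸ (x % d + y / d * d)  ≡⟨ [m+n]∸[m+o]≡n∸o (x % d) _ _ ⟩
  x / d * d ∸ y / d * d                      ≡⟨ *-distribʳ-∸ d (x / d) (y / d) ⟨
  (x / d ∸ y / d) * d                        ∎)
  where
    open ≡-Reasoning
    y≡ : y ≡ x % d + y / d * d
    y≡ = trans (m≡m%n+[m/n]*n y d) (cong (_+ y / d * d) (sym x≡y))

crt-unique-≤ : ∀ q M .{{_ : NonZero q}} .{{_ : NonZero M}} → Coprime q M →
               ∀ {x y} → y ≤ x → x % q ≡ y % q → x % M ≡ y % M →
               (x % (q * M)) {{m*n≢0 q M}} ≡ (y % (q * M)) {{m*n≢0 q M}}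
crt-unique-≤ q M q⊥M {x} {y} y≤x x≡y[q] x≡y[M] = begin
  x % (q * M)            ≡⟨ cong (_% (q * M)) (m+[n∸m]≡n y≤x) ⟨
  (y + (x ∸ y)) % (q * M) ≡⟨ %-remove-+ʳ y qM∣x∸y ⟩
  y % (q * M)            ∎
  where
    open ≡-Reasoning
    instance _ = m*n≢0 q M
    qM∣x∸y : q * M ∣ x ∸ y
    qM∣x∸y = coprime-∣-* q⊥M (%-≡⇒∣∸ x y q y≤x x≡y[q]) (%-≡⇒∣∸ x y M y≤x x≡y[M])

crt-unique : ∀ q M .{{_ : NonZero q}} .{{_ : NonZero M}} → Coprime q M →
             ∀ x y → x % q ≡ y % q → x % M ≡ y % M →
             (x % (q * M)) {{m*n≢0 q M}} ≡ (y % (q * M)) {{m*n≢0 q M}}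
crt-unique q M q⊥M x y x≡y[q] x≡y[M] with ≤-total y x
... | inj₁ y≤x = crt-unique-≤ q M q⊥M y≤x x≡y[q] x≡y[M]
... | inj₂ x≤y = sym (crt-unique-≤ q M q⊥M x≤y (sym x≡y[q]) (sym x≡y[M]))

bezout-meet : ∀ P T .{{_ : NonZero T}} x y → 1 + y * T ≡ x * P →
              ∀ n₁ n₂ → ∃[ t₁ ] ∃[ t₂ ] (n₁ + t₁ * P ≡ n₂ + t₂ * T)
bezout-meet P (suc T) x y 1+yT≡xP n₁ n₂ = x * c , n₁ + y * c , (begin
  n₁ + x * c * P              ≡⟨ reassoc n₁ x c P ⟩
  n₁ + c * (x * P)            ≡⟨ cong (λ u → n₁ + c * u) 1+yT≡xP ⟨
  n₁ + c * (1 + y * suc T)    ≡⟨ expand n₁ n₂ T y ⟩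
  n₂ + (n₁ + y * c) * suc T   ∎)
  where
    open ≡-Reasoning
    open +-*-Solver
    c : ℕ
    c = n₂ + n₁ * T
    reassoc : ∀ n₁ x c P → n₁ + x * c * P ≡ n₁ + c * (x * P)
    reassoc = solve 4 (λ n₁ x c P → n₁ :+ x :* c :* P := n₁ :+ c :* (x :* P)) refl
    expand : ∀ n₁ n₂ T y → n₁ + (n₂ + n₁ * T) * (1 + y * suc T) ≡ n₂ + (n₁ + y * (n₂ + n₁ * T)) * suc T
    expand = solve 4 (λ n₁ n₂ T y →
      n₁ :+ (n₂ :+ n₁ :* T) :* (con 1 :+ y :* (con 1 :+ T)) :=
      n₂ :+ (n₁ :+ y :* (n₂ :+ n₁ :* T)) :* (con 1 :+ T)) refl

crt-exists : ∀ P T .{{_ : NonZero P}} .{{_ : NonZero T}} → Coprime P T →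
             ∀ n₁ n₂ → ∃[ t₁ ] ∃[ t₂ ] (n₁ + t₁ * P ≡ n₂ + t₂ * T)
crt-exists P T P⊥T n₁ n₂ with coprime-Bézout P⊥T
... | Bézout.+- x y eq = bezout-meet P T x y eq n₁ n₂
... | Bézout.-+ x y eq with bezout-meet T P y x eq n₂ n₁
...   | t₂ , t₁ , meet = t₁ , t₂ , sym meet

periodic-* : ∀ f q M P T .{{_ : NonZero q}} .{{_ : NonZero M}} → Coprime q M →
             Periodic f q P → Periodic f M T → Periodic f (q * M) {{m*n≢0 q M}} (P * T)
periodic-* f q M P T q⊥M periodic-q periodic-M n t = crt-unique q M q⊥M _ _
  (trans (cong (λ s → f (n + s) % q) tPT≡tTP) (periodic-q n (t * T)))
  (trans (cong (λ s → f (n + s) % M) (sym (*-assoc t P T))) (periodic-M n (t * P)))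
  where
    tPT≡tTP : t * (P * T) ≡ t * T * P
    tPT≡tTP = trans (cong (t *_) (*-comm P T)) (sym (*-assoc t T P))

hitsAll-* : ∀ f q M P T .{{_ : NonZero q}} .{{_ : NonZero M}} .{{_ : NonZero P}} .{{_ : NonZero T}} →
            Coprime q M → Coprime P T → Periodic f q P → Periodic f M T →
            HitsAllResidues f q → HitsAllResidues f M → HitsAllResidues f (q * M) {{m*n≢0 q M}}
hitsAll-* f q M P T q⊥M P⊥T periodic-q periodic-M hits-q hits-M r r<qM
  with hits-q (r % q) (m%n<n r q) | hits-M (r % M) (m%n<n r M)
... | n₁ , fn₁≡r[q] | n₂ , fn₂≡r[M] with crt-exists P T P⊥T n₁ n₂
... | t₁ , t₂ , meet = n₁ + t₁ * P , (begin
  f N % (q * M) ≡⟨ crt-unique q M q⊥M (f N) r fN≡r[q] fN≡r[M] ⟩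
  r % (q * M)   ≡⟨ m<n⇒m%n≡m r<qM ⟩
  r             ∎)
  where
    open ≡-Reasoning
    instance _ = m*n≢0 q M
    N : ℕ
    N = n₁ + t₁ * P
    fN≡r[q] : f N % q ≡ r % q
    fN≡r[q] = trans (periodic-q n₁ t₁) fn₁≡r[q]
    fN≡r[M] : f N % M ≡ r % M
    fN≡r[M] = trans (cong (λ m → f m % M) meet) (trans (periodic-M n₂ t₂) fn₂≡r[M])

universal⇔hitsAll : ∀ k m .{{_ : NonZero m}} → KUniversal k m ⇔ HitsAllResidues (_C k) m
universal⇔hitsAll k (suc m) = mk⇔ id id

-- Universality passes to divisors: reduce a witness modulo M further modulo d.
universal-divisor : ∀ {k M d} → KUniversal k M → d ∣ M → KUniversal k d
universal-divisor {M = suc M} {zero} _ 0∣M with 0∣⇒≡0 0∣M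
... | ()
universal-divisor {k} {suc M} {suc d} univ d∣M r r<d with univ r (<-≤-trans r<d (∣⇒≤ d∣M))
... | n , nCk≡r[M] = n , (begin
  (n C k) % suc d          ≡⟨ m∣n⇒o%n%m≡o%m (suc d) (suc M) (n C k) d∣M ⟨
  (n C k) % suc M % suc d  ≡⟨ cong (_% suc d) nCk≡r[M] ⟩
  r % suc d                ≡⟨ m<n⇒m%n≡m r<d ⟩
  r                        ∎)
  where open ≡-Reasoning

powerProduct : (ℕ × ℕ → ℕ) → List (ℕ × ℕ) → ℕ
powerProduct e ps = product (map (λ pa → proj₁ pa ^ e pa) ps)

binomialPeriod : ℕ → List (ℕ × ℕ) → ℕ
binomialPeriod k = powerProduct (λ pa → k + proj₂ pa)

prime-power-nonZero : ∀ {p} → Prime p → ∀ a → NonZero (p ^ a)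
prime-power-nonZero {p} pp a = m^n≢0 p a {{prime⇒nonZero pp}}

powerProduct-nonZero : ∀ {ps} → All (λ pa → Prime (proj₁ pa)) ps → ∀ e → NonZero (powerProduct e ps)
powerProduct-nonZero []                      e = _
powerProduct-nonZero {(p , a) ∷ ps} (pp ∷ pps) e =
  m*n≢0 (p ^ e (p , a)) (powerProduct e ps) {{prime-power-nonZero pp (e (p , a))}} {{powerProduct-nonZero pps e}}

coprime-powerProduct : ∀ {p ps} → Prime p → All (λ pa → Prime (proj₁ pa)) ps →
                       All (p ≢_) (map proj₁ ps) → ∀ b e → Coprime (p ^ b) (powerProduct e ps)
coprime-powerProduct pp []         []         b e = Coprime.sym (1-coprimeTo _)
coprime-powerProduct {p} {(q , c) ∷ ps} pp (pq ∷ pqs) (p≢q ∷ p≢qs) b e =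
  coprime-*ʳ (coprime-^ b (e (q , c)) (distinct-primes-coprime pp pq p≢q)) (coprime-powerProduct pp pqs p≢qs b e)

factors-∣-primePowerProduct : ∀ ps → All (λ pa → proj₁ pa ^ proj₂ pa ∣ primePowerProduct ps) ps
factors-∣-primePowerProduct []             = []
factors-∣-primePowerProduct ((p , a) ∷ ps) =
  m∣m*n (primePowerProduct ps) ∷ All.map (λ d∣M → ∣-trans d∣M (n∣m*n (p ^ a))) (factors-∣-primePowerProduct ps)

binomial-periodic-product : ∀ k {ps} (pps : All (λ pa → Prime (proj₁ pa)) ps) → Unique (map proj₁ ps) →
  Periodic (_C k) (primePowerProduct ps) {{powerProduct-nonZero pps proj₂}} (binomialPeriod k ps)
binomial-periodic-product k [] [] n t = trans (n%1≡0 ((n + t * 1) C k)) (sym (n%1≡0 (n C k)))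
binomial-periodic-product k {(p , a) ∷ ps} (pp ∷ pps) (p≢ps ∷ unique) =
  periodic-* (_C k) (p ^ a) (primePowerProduct ps) (p ^ (k + a)) (binomialPeriod k ps)
    (coprime-powerProduct pp pps p≢ps a proj₂)
    (binomial-periodic (p ^ a) (p ^ (k + a)) k (p^a∣C pp a k))
    (binomial-periodic-product k pps unique)
  where instance
    _ = prime-power-nonZero pp a
    _ = powerProduct-nonZero pps proj₂

hitsAll-product : ∀ k {ps} (pps : All (λ pa → Prime (proj₁ pa)) ps) → Unique (map proj₁ ps) →
  All (λ pa → KUniversal k (proj₁ pa ^ proj₂ pa)) ps →
  HitsAllResidues (_C k) (primePowerProduct ps) {{powerProduct-nonZero pps proj₂}}
hitsAll-product k [] [] [] zero    _          = 0 , n%1≡0 (0 C k)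
hitsAll-product k [] [] [] (suc r) (s≤s ())
hitsAll-product k {(p , a) ∷ ps} (pp ∷ pps) (p≢ps ∷ unique) (univ-p^a ∷ univ-ps) =
  hitsAll-* (_C k) (p ^ a) (primePowerProduct ps) (p ^ (k + a)) (binomialPeriod k ps)
    (coprime-powerProduct pp pps p≢ps a proj₂)
    (coprime-powerProduct pp pps p≢ps (k + a) (λ pa → k + proj₂ pa))
    (binomial-periodic (p ^ a) (p ^ (k + a)) k (p^a∣C pp a k))
    (binomial-periodic-product k pps unique)
    (Equivalence.to (universal⇔hitsAll k (p ^ a)) univ-p^a)
    (hitsAll-product k pps unique univ-ps)
  where instance
    _ = prime-power-nonZero pp a
    _ = prime-power-nonZero pp (k + a)
    _ = powerProduct-nonZero pps proj₂
    _ = powerProduct-nonZero pps (λ pa → k + proj₂ pa)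

proposition1p1 : (k : ℕ) → k ≥ 1 → (ps : List (ℕ × ℕ)) →
    All (λ pa → Prime (proj₁ pa)) ps → Unique (map proj₁ ps) →
    All (λ pa → proj₂ pa ≥ 1) ps →
    KUniversal k (primePowerProduct ps) ⇔
      All (λ pa → KUniversal k (proj₁ pa ^ proj₂ pa)) ps
proposition1p1 k _ ps primes unique _ = mk⇔
  (λ univ → All.map (universal-divisor univ) (factors-∣-primePowerProduct ps))
  (λ univ-factors → Equivalence.from (universal⇔hitsAll k (primePowerProduct ps))
                      (hitsAll-product k primes unique univ-factors))
  where instance _ = powerProduct-nonZero primes proj₂
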